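{- Let $s\ge1$ and $n>s+1$. Then $$\beta_{1,3}(s,1,n)=\sum_{\ell=2}^{s}\gamma^\ell(s,n),$$ where $\gamma^\ell(s,n)$ is the number of continuous multiline queues of type $(s,1,n-s-1)$ with rows $a_1<\cdots<a_s$, $b_1<\cdots<b_{s+1}$, $c_1<\cdots<c_n$ satisfying $c_2=\ell$, $c_n=N$ and $b_1>c_2$, whose projected word $\omega$ has $\omega_1=1$ and $\omega_2=3$.
   Context: For nonnegative integers $s,t,n$ with $s+t\le n$: a continuous multiline queue of type $(s,t,n-s-t)$ is a three-row array whose rows are strictly increasing sequences $a_1<\cdots<a_s$, $b_1<\cdots<b_{s+t}$, $c_1<\cdots<c_n$, whose $N=n+2s+t$ entries are exactly $1,\ldots,N$, each once. Bully path procedure: initially all entries are available. First, each entry of row 1 starts a bully path; then each still-available entry of row 2 starts a bully path. An entry $x$ on a path bullies the smallest available entry of the next row larger than $x$, or, if there is none, the smallest available entry of the next row (a wrapping from that row to the next); bullied entries become unavailable and the path continues to row 3. Endpoints of paths starting in row 1 get label 1, those starting in row 2 get label 2, remaining entries of row 3 get label 3. The projected word is $\omega=(\omega_1,\ldots,\omega_n)$, $\omega_k$ the label of $c_k$. $\beta_{1,3}(s,t,n)$ is the number of continuous multiline queues of type $(s,t,n-s-t)$ with $c_n=N$ and exactly one wrapping from the second row to the third row, whose projected word has $\omega_1=1$ and $\omega_2=3$. An empty sum equals $0$. -}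

module Defs where

open import Data.Nat using (ℕ; zero; suc; _+_; _*_; _∸_; _<ᵇ_; _≡ᵇ_)
open import Data.Bool using (Bool; true; false; _∧_; if_then_else_; not)
open import Data.List using (List; []; _∷_; map; concatMap; length; filter; upTo; _++_)
open import Data.Nat.ListAction using (sum)
open import Data.Maybe using (Maybe; just; nothing)
open import Data.Product using (_×_; _,_)
open import Relation.Nullary.Decidable using (Dec; yes; no)
open import Relation.Binary.PropositionalEquality using (_≡_)
open import Data.Bool using (T)
open import Relation.Nullary.Decidable using (does)
open import Data.Bool.Properties using (T?)

-- A continuous multiline queue of type (s,t,n-s-t) is a placement of
-- 1..N (N = n+2s+t) into three rows of sizes s, s+t, n.  We encode it by
-- the word r ∈ {1,2,3}^N with r(x) = row of entry x; each row is then the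
-- increasing list of entries carrying that row label.

data Row : Set where
  r1 r2 r3 : Row

record MLQ : Set where
  constructor mlq
  field
    row1 : List ℕ
    row2 : List ℕ
    row3 : List ℕ
open MLQ public

words : ℕ → List (List Row)
words zero    = [] ∷ []
words (suc m) = concatMap (λ w → (r1 ∷ w) ∷ (r2 ∷ w) ∷ (r3 ∷ w) ∷ []) (words m)

isR1 isR2 isR3 : Row → Bool
isR1 r1 = true
isR1 _  = false
isR2 r2 = true
isR2 _  = false
isR3 r3 = true
isR3 _  = false

count : (Row → Bool) → List Row → ℕ
count p []      = 0
count p (x ∷ w) = if p x then suc (count p w) else count p w

entries : (Row → Bool) → ℕ → List Row → List ℕ
entries p k []      = []
entries p k (x ∷ w) = if p x then k ∷ entries p (suc k) w else entries p (suc k) w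

toMLQ : List Row → MLQ
toMLQ w = mlq (entries isR1 1 w) (entries isR2 1 w) (entries isR3 1 w)

hasType : ℕ → ℕ → ℕ → List Row → Bool
hasType s t n w = (count isR1 w ≡ᵇ s) ∧ (count isR2 w ≡ᵇ (s + t)) ∧ (count isR3 w ≡ᵇ n)

cMLQs : ℕ → ℕ → ℕ → List MLQ
cMLQs s t n = map toMLQ (filter (λ w → T? (hasType s t n w)) (words (n + 2 * s + t)))

firstAbove : ℕ → List ℕ → Maybe ℕ
firstAbove x []      = nothing
firstAbove x (y ∷ l) = if x <ᵇ y then just y else firstAbove x l

-- the entry bullied by x among the available (increasing) entries of the
-- next row, together with a flag telling whether this step is a wrapping
bully : ℕ → List ℕ → Maybe (ℕ × Bool)
bully x l with firstAbove x l
... | just y  = just (y , false)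
... | nothing with l
...   | []    = nothing
...   | y ∷ _ = just (y , true)

remove : ℕ → List ℕ → List ℕ
remove x []      = []
remove x (y ∷ l) = if x ≡ᵇ y then l else y ∷ remove x l

-- state: available row-2 entries, available row-3 entries,
--        labelled row-3 entries, number of wrappings from row 2 to row 3
record St : Set where
  constructor st
  field
    av2   : List ℕ
    av3   : List ℕ
    lab   : List (ℕ × ℕ)
    wraps : ℕ
open St public

b2n : Bool → ℕ
b2n true  = 1
b2n false = 0

step23 : ℕ → ℕ → St → Maybe St
step23 ℓ b (st a2 a3 lb wr) with bully b a3
... | nothing      = nothing
... | just (c , w) = just (st a2 (remove c a3) ((c , ℓ) ∷ lb) (b2n w + wr))

path1 : ℕ → St → Maybe St
path1 a (st a2 a3 lb wr) with bully a a2
... | nothing      = nothing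
... | just (b , _) = step23 1 b (st (remove b a2) a3 lb wr)

runRow1 : List ℕ → Maybe St → Maybe St
runRow1 []      m        = m
runRow1 (a ∷ l) nothing  = nothing
runRow1 (a ∷ l) (just σ) = runRow1 l (path1 a σ)

runRow2 : List ℕ → Maybe St → Maybe St
runRow2 []      m        = m
runRow2 (b ∷ l) nothing  = nothing
runRow2 (b ∷ l) (just σ) = runRow2 l (step23 2 b σ)

bullyRun : MLQ → Maybe St
bullyRun q with runRow1 (row1 q) (just (st (row2 q) (row3 q) [] 0))
... | nothing = nothing
... | just σ  = runRow2 (av2 σ) (just σ)

lookupLabel : ℕ → List (ℕ × ℕ) → ℕ
lookupLabel c []             = 3
lookupLabel c ((d , ℓ) ∷ l) = if c ≡ᵇ d then ℓ else lookupLabel c l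

-- projected word ω : ω_k = label of c_k (unlabelled row-3 entries get 3)
projWord : MLQ → Maybe (List ℕ)
projWord q with bullyRun q
... | nothing = nothing
... | just σ  = just (map (λ c → lookupLabel c (lab σ)) (row3 q))

wraps23 : MLQ → Maybe ℕ
wraps23 q with bullyRun q
... | nothing = nothing
... | just σ  = just (wraps σ)

lastIs : ℕ → List ℕ → Bool
lastIs N []          = false
lastIs N (x ∷ [])    = x ≡ᵇ N
lastIs N (x ∷ y ∷ l) = lastIs N (y ∷ l)

starts13 : Maybe (List ℕ) → Bool
starts13 (just (x ∷ y ∷ _)) = (x ≡ᵇ 1) ∧ (y ≡ᵇ 3)
starts13 _                  = false

oneWrap : Maybe ℕ → Bool
oneWrap (just k) = k ≡ᵇ 1
oneWrap nothing  = false

secondIs : ℕ → List ℕ → Bool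
secondIs ℓ (_ ∷ y ∷ _) = y ≡ᵇ ℓ
secondIs ℓ _           = false

b1AboveC2 : MLQ → Bool
b1AboveC2 (mlq _ (b ∷ _) (_ ∷ c ∷ _)) = c <ᵇ b
b1AboveC2 _                           = false

countWhere : (MLQ → Bool) → List MLQ → ℕ
countWhere p l = length (filter (λ q → T? (p q)) l)

β13 : ℕ → ℕ → ℕ → ℕ
β13 s t n = countWhere
  (λ q → lastIs (n + 2 * s + t) (row3 q) ∧ oneWrap (wraps23 q) ∧ starts13 (projWord q))
  (cMLQs s t n)

γ : ℕ → ℕ → ℕ → ℕ
γ ℓ s n = countWhere
  (λ q → secondIs ℓ (row3 q) ∧ lastIs (n + 2 * s + 1) (row3 q) ∧ b1AboveC2 q
         ∧ starts13 (projWord q))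
  (cMLQs s 1 n)

sumFromTo : ℕ → ℕ → (ℕ → ℕ) → ℕ
sumFromTo a b f = sum (map (λ i → f (a + i)) (upTo (suc b ∸ a)))

-- Write the rows as A, B and C = c₁ < c₂ < ⋯ with N = max C.  Since |B| = |A| + 1, exactly
-- one row-2 entry bS survives the row-1 paths, and ω₁ = 1, ω₂ = 3 say that c₁ is taken by a
-- row-1 path while c₂ is never taken.  As long as c₂ is available every wrapping lands on c₁,
-- so there is at most one wrapping, and the path of bS does not wrap.  If B lies above c₂,
-- only a wrapping can reach c₁, so there is exactly one; if some b < c₂ lies in B, its path
-- takes c₁ without wrapping and no wrapping follows.  When there is a wrapping, N disappeared
-- before it, and the potential [N taken] + #wrappings, which ends at 2, rises only along paths
-- from row-1 entries above c₂.  With B above c₂ the entries below c₂ are c₁ and those of A,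
-- so c₂ ≤ s.  Hence β₁,₃ counts the queues with c₂ < b₁ and 2 ≤ c₂ ≤ s, and splitting them
-- by ℓ = c₂ gives the γ^ℓ.

module Submission where

open import Defs
open import Data.Nat using (ℕ; _+_; _≤_; _<_)
open import Relation.Binary.PropositionalEquality using (_≡_)

open import Data.Nat using (_*_; zero; suc; _∸_; _<ᵇ_; _≡ᵇ_; _≤ᵇ_; z≤n; s≤s; z<s; _≮_)
open import Data.Nat.Properties
open import Data.Bool using (Bool; true; false; _∧_; if_then_else_; T)
open import Data.Bool.Properties using (∧-zeroʳ; ∧-identityʳ; T-∧; T?)
open import Data.List using (List; []; _∷_; length; map; upTo; _∷ʳ_; _++_)
open import Data.List.Properties using (map-cong; map-++; upTo-∷ʳ; ∷-injective)
open import Data.Nat.ListAction using (sum)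
open import Data.Nat.ListAction.Properties using (sum-++)
open import Algebra.Properties.CommutativeSemigroup +-commutativeSemigroup using (interchange)
open import Data.List.Relation.Unary.All as All using (All; []; _∷_)
open import Data.List.Relation.Unary.AllPairs as AllPairs using (AllPairs; []; _∷_)
open import Data.List.Relation.Unary.Any using (here; there)
open import Data.List.Membership.Propositional using (_∈_; _∉_; find)
open import Data.List.Membership.Propositional.Properties using (∈-map⁻; ∈-filter⁻; ∈-concatMap⁻)
open import Data.List.Membership.DecPropositional _≟_ using (_∈?_)
open import Data.List.Relation.Binary.Subset.Propositional using (_⊆_)
open import Data.Maybe using (just; nothing)
open import Data.Product using (_×_; _,_; ∃; ∃₂; proj₁; proj₂)
open import Data.Sum using (_⊎_; inj₁; inj₂; [_,_])
open import Data.Empty using (⊥; ⊥-elim)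
open import Function using (_∘_; Equivalence)
open import Relation.Binary.PropositionalEquality
  using (_≢_; refl; sym; trans; cong; cong₂; subst; module ≡-Reasoning)
open import Relation.Nullary using (¬_; yes; no; does; contradiction)
open import Relation.Nullary.Decidable using (dec-true; dec-false)
open import Relation.Nullary.Reflects using (Reflects; ofʸ; ofⁿ; fromEquivalence; det; _×-reflects_)

Increasing : List ℕ → Set
Increasing = AllPairs _<_

≡ᵇ-reflects-≡ : ∀ m n → Reflects (m ≡ n) (m ≡ᵇ n)
≡ᵇ-reflects-≡ m n = fromEquivalence (≡ᵇ⇒≡ m n) (≡⇒≡ᵇ m n)

reflects-≡ : ∀ {P Q : Set} {p q} → Reflects P p → Reflects Q q → (P → Q) → (Q → P) → p ≡ q
reflects-≡ (ofʸ _) (ofʸ _) _ _ = refl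
reflects-≡ (ofʸ p) (ofⁿ ¬q) to _ = contradiction (to p) ¬q
reflects-≡ (ofⁿ ¬p) (ofʸ q) _ from = contradiction (from q) ¬p
reflects-≡ (ofⁿ _) (ofⁿ _) _ _ = refl

<ᵇ-true : ∀ {m n} → m < n → (m <ᵇ n) ≡ true
<ᵇ-true {m} {n} m<n = det (<ᵇ-reflects-< m n) (ofʸ m<n)

<ᵇ-false : ∀ {m n} → m ≮ n → (m <ᵇ n) ≡ false
<ᵇ-false {m} {n} m≮n = det (<ᵇ-reflects-< m n) (ofⁿ m≮n)

firstAbove-just : ∀ {x y l} → Increasing l → firstAbove x l ≡ just y →
  y ∈ l × x < y × (∀ {z} → z ∈ l → x < z → y ≤ z)
firstAbove-just {x} {y} {v ∷ l} (v<l ∷ inc) e with x <ᵇ v | <ᵇ-reflects-< x v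
... | true | ofʸ x<v with refl ← e = here refl , x<v , least
  where
  least : ∀ {z} → z ∈ v ∷ l → x < z → v ≤ z
  least (here refl) _ = ≤-refl
  least (there z∈l) _ = <⇒≤ (All.lookup v<l z∈l)
... | false | ofⁿ x≮v with y∈l , x<y , least ← firstAbove-just inc e = there y∈l , x<y , least′
  where
  least′ : ∀ {z} → z ∈ v ∷ l → x < z → y ≤ z
  least′ (here refl) x<z = contradiction x<z x≮v
  least′ (there z∈l) x<z = least z∈l x<z

firstAbove-nothing : ∀ {x l} → firstAbove x l ≡ nothing → ∀ {z} → z ∈ l → z ≤ x
firstAbove-nothing {x} {v ∷ l} e z∈ with x <ᵇ v | <ᵇ-reflects-< x v
firstAbove-nothing {x} {v ∷ l} () z∈ | true | _
firstAbove-nothing {x} {v ∷ l} e (here refl) | false | ofⁿ x≮v = ≮⇒≥ x≮v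
firstAbove-nothing {x} {v ∷ l} e (there z∈) | false | _ = firstAbove-nothing e z∈

data Bullies (x : ℕ) (l : List ℕ) : ℕ → Bool → Set where
  noWrap : ∀ {y} → y ∈ l → x < y → (∀ {z} → z ∈ l → x < z → y ≤ z) → Bullies x l y false
  wrap   : ∀ {y} → y ∈ l → (∀ {z} → z ∈ l → z ≤ x) → (∀ {z} → z ∈ l → y ≤ z) → Bullies x l y true

bully-spec : ∀ {x l y w} → Increasing l → bully x l ≡ just (y , w) → Bullies x l y w
bully-spec {x} {l} inc e with firstAbove x l in fa
bully-spec inc refl | just y with y∈l , x<y , least ← firstAbove-just inc fa = noWrap y∈l x<y least
bully-spec {l = l} inc e | nothing with l
bully-spec (y<l ∷ _) refl | nothing | y ∷ l = wrap (here refl) (firstAbove-nothing fa) minimum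
  where
  minimum : ∀ {z} → z ∈ y ∷ l → y ≤ z
  minimum (here refl) = ≤-refl
  minimum (there z∈l) = <⇒≤ (All.lookup y<l z∈l)

Bullies-∈ : ∀ {x l y w} → Bullies x l y w → y ∈ l
Bullies-∈ (noWrap y∈l _ _) = y∈l
Bullies-∈ (wrap y∈l _ _) = y∈l

Bullies-skipped : ∀ {x l y w z} → Bullies x l y w → z ∈ l → z < y → z ≤ x
Bullies-skipped (wrap _ below _) z∈l _ = below z∈l
Bullies-skipped (noWrap _ _ least) z∈l z<y = ≮⇒≥ λ x<z → <⇒≱ z<y (least z∈l x<z)

∈-remove⁻ : ∀ {y z l} → z ∈ remove y l → z ∈ l
∈-remove⁻ {y} {l = v ∷ l} z∈ with y ≡ᵇ v
... | true = there z∈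
∈-remove⁻ (here refl) | false = here refl
∈-remove⁻ (there z∈) | false = there (∈-remove⁻ z∈)

∈-remove⁺ : ∀ {y z l} → z ∈ l → z ≢ y → z ∈ remove y l
∈-remove⁺ {y} {l = v ∷ l} z∈ z≢y with y ≡ᵇ v | ≡ᵇ-reflects-≡ y v
∈-remove⁺ (here refl) z≢y | true | ofʸ refl = contradiction refl z≢y
∈-remove⁺ (there z∈) z≢y | true | _ = z∈
∈-remove⁺ (here refl) z≢y | false | _ = here refl
∈-remove⁺ (there z∈) z≢y | false | _ = there (∈-remove⁺ z∈ z≢y)

∈-remove⇒≢ : ∀ {y z l} → Increasing l → z ∈ remove y l → z ≢ y
∈-remove⇒≢ {y} {l = v ∷ l} (v<l ∷ inc) z∈ with y ≡ᵇ v | ≡ᵇ-reflects-≡ y v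
... | true | ofʸ refl = λ { refl → <-irrefl refl (All.lookup v<l z∈) }
∈-remove⇒≢ (v<l ∷ inc) (here refl) | false | ofⁿ y≢v = y≢v ∘ sym
∈-remove⇒≢ (v<l ∷ inc) (there z∈) | false | _ = ∈-remove⇒≢ inc z∈

remove-all : ∀ {P : ℕ → Set} {y l} → All P l → All P (remove y l)
remove-all [] = []
remove-all {y = y} {v ∷ l} (pv ∷ pl) with y ≡ᵇ v
... | true = pl
... | false = pv ∷ remove-all pl

remove-increasing : ∀ {y l} → Increasing l → Increasing (remove y l)
remove-increasing [] = []
remove-increasing {y} {v ∷ l} (v<l ∷ inc) with y ≡ᵇ v
... | true = inc
... | false = remove-all v<l ∷ remove-increasing inc

length-remove : ∀ {y l} → y ∈ l → length l ≡ suc (length (remove y l))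
length-remove {y} {v ∷ l} y∈ with y ≡ᵇ v | ≡ᵇ-reflects-≡ y v
... | true | _ = refl
length-remove (here refl) | false | ofⁿ y≢y = contradiction refl y≢y
length-remove (there y∈) | false | _ = cong suc (length-remove y∈)

lookupLabel-∷ : ∀ {c y ℓ k lb} → lookupLabel c ((y , ℓ) ∷ lb) ≡ k → k ≢ ℓ →
  c ≢ y × lookupLabel c lb ≡ k
lookupLabel-∷ {c} {y} e k≢ℓ with c ≡ᵇ y | ≡ᵇ-reflects-≡ c y
... | true | _ = contradiction (sym e) k≢ℓ
... | false | ofⁿ c≢y = c≢y , e

lookupLabel-∷-≢ : ∀ {c y ℓ lb} → c ≢ y → lookupLabel c ((y , ℓ) ∷ lb) ≡ lookupLabel c lb
lookupLabel-∷-≢ {c} {y} c≢y with c ≡ᵇ y | ≡ᵇ-reflects-≡ c y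
... | true | ofʸ c≡y = contradiction c≡y c≢y
... | false | _ = refl

-- The bully path procedure, step by step

data Row3Step (ℓ b : ℕ) : St → St → Set where
  bullies : ∀ {a2 a3 lb wr y w} → bully b a3 ≡ just (y , w) →
    Row3Step ℓ b (st a2 a3 lb wr) (st a2 (remove y a3) ((y , ℓ) ∷ lb) (b2n w + wr))

data Row1Path (a : ℕ) : St → St → Set where
  path : ∀ {a2 a3 lb wr b w σ'} → bully a a2 ≡ just (b , w) →
    Row3Step 1 b (st (remove b a2) a3 lb wr) σ' → Row1Path a (st a2 a3 lb wr) σ'

data Row1Run : List ℕ → St → St → Set where
  []  : ∀ {σ} → Row1Run [] σ σ
  _∷_ : ∀ {a as σ τ σ'} → Row1Path a σ τ → Row1Run as τ σ' → Row1Run (a ∷ as) σ σ'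

step23-view : ∀ {ℓ b σ σ'} → step23 ℓ b σ ≡ just σ' → Row3Step ℓ b σ σ'
step23-view {ℓ} {b} {st a2 a3 lb wr} e with bully b a3 in eb
step23-view {ℓ} {b} {st a2 a3 lb wr} refl | just (y , w) = bullies eb

path1-view : ∀ {a σ σ'} → path1 a σ ≡ just σ' → Row1Path a σ σ'
path1-view {a} {st a2 a3 lb wr} e with bully a a2 in eb
... | just (b , w) = path eb (step23-view e)

runRow1-view : ∀ {as σ σ'} → runRow1 as (just σ) ≡ just σ' → Row1Run as σ σ'
runRow1-view {[]} refl = []
runRow1-view {a ∷ as} {σ} e with path1 a σ in ep
... | just τ = path1-view ep ∷ runRow1-view e
... | nothing = contradiction (trans (sym e) (halted as)) λ ()
  where
  halted : ∀ as → runRow1 as nothing ≡ nothing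
  halted []      = refl
  halted (_ ∷ _) = refl

bullyRun-view : ∀ {A B C σf} → bullyRun (mlq A B C) ≡ just σf →
  ∃ λ σ₁ → Row1Run A (st B C [] 0) σ₁ × runRow2 (av2 σ₁) (just σ₁) ≡ just σf
bullyRun-view {A} {B} {C} e with runRow1 A (just (st B C [] 0)) in e₁
... | just σ₁ = σ₁ , runRow1-view e₁ , e

Row1Run-⊆ : ∀ {as σ σ'} → Row1Run as σ σ' → av2 σ' ⊆ av2 σ × av3 σ' ⊆ av3 σ
Row1Run-⊆ [] = (λ z∈ → z∈) , (λ z∈ → z∈)
Row1Run-⊆ (path _ (bullies _) ∷ run) with ⊆₂ , ⊆₃ ← Row1Run-⊆ run =
  ∈-remove⁻ ∘ ⊆₂ , ∈-remove⁻ ∘ ⊆₃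

record WellFormed (B C : List ℕ) (σ : St) : Set where
  field
    av2-increasing : Increasing (av2 σ)
    av2⊆B : av2 σ ⊆ B
    av3-increasing : Increasing (av3 σ)
    av3⊆C : av3 σ ⊆ C
    available⇒unlabelled : ∀ {c} → c ∈ av3 σ → lookupLabel c (lab σ) ≡ 3
    unlabelled⇒available : ∀ {c} → c ∈ C → lookupLabel c (lab σ) ≡ 3 → c ∈ av3 σ

module _ {B C : List ℕ} where
  open WellFormed

  initial-wellFormed : Increasing B → Increasing C → WellFormed B C (st B C [] 0)
  initial-wellFormed B-inc C-inc = record
    { av2-increasing = B-inc ; av2⊆B = λ b∈ → b∈
    ; av3-increasing = C-inc ; av3⊆C = λ c∈ → c∈
    ; available⇒unlabelled = λ _ → refl ; unlabelled⇒available = λ c∈ _ → c∈ }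

  Row3Step-wellFormed : ∀ {ℓ b σ σ'} → Row3Step ℓ b σ σ' → ℓ ≢ 3 →
    WellFormed B C σ → WellFormed B C σ'
  Row3Step-wellFormed (bullies {lb = lb} _) ℓ≢3 wf = record
    { av2-increasing = av2-increasing wf
    ; av2⊆B = av2⊆B wf
    ; av3-increasing = remove-increasing (av3-increasing wf)
    ; av3⊆C = av3⊆C wf ∘ ∈-remove⁻
    ; available⇒unlabelled = λ c∈ →
        trans (lookupLabel-∷-≢ {lb = lb} (∈-remove⇒≢ (av3-increasing wf) c∈))
              (available⇒unlabelled wf (∈-remove⁻ c∈))
    ; unlabelled⇒available = λ c∈C unlabelled →
        let c≢y , unlabelled′ = lookupLabel-∷ {lb = lb} unlabelled (ℓ≢3 ∘ sym)
        in ∈-remove⁺ (unlabelled⇒available wf c∈C unlabelled′) c≢y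
    }

  Row1Path-wellFormed : ∀ {a σ σ'} → Row1Path a σ σ' → WellFormed B C σ → WellFormed B C σ'
  Row1Path-wellFormed (path _ step) wf = Row3Step-wellFormed step (λ ()) (record
    { av2-increasing = remove-increasing (av2-increasing wf)
    ; av2⊆B = av2⊆B wf ∘ ∈-remove⁻
    ; av3-increasing = av3-increasing wf
    ; av3⊆C = av3⊆C wf
    ; available⇒unlabelled = available⇒unlabelled wf
    ; unlabelled⇒available = unlabelled⇒available wf
    })

  module _ (P : St → Set)
           (preserved : ∀ {a σ σ'} → Row1Path a σ σ' → WellFormed B C σ → P σ → P σ') where

    Row1Run-preserves : ∀ {as σ σ'} → Row1Run as σ σ' → WellFormed B C σ → P σ → P σ'
    Row1Run-preserves [] wf p = p
    Row1Run-preserves (step ∷ run) wf p =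
      Row1Run-preserves run (Row1Path-wellFormed step wf) (preserved step wf p)

  Row1Run-wellFormed : ∀ {as σ σ'} → Row1Run as σ σ' → WellFormed B C σ → WellFormed B C σ'
  Row1Run-wellFormed run wf =
    Row1Run-preserves (WellFormed B C) (λ step _ → Row1Path-wellFormed step) run wf wf

  Row1Run-length : ∀ {as σ σ'} → Row1Run as σ σ' → WellFormed B C σ →
    length (av2 σ) ≡ length as + length (av2 σ')
  Row1Run-length [] wf = refl
  Row1Run-length (step@(path e (bullies _)) ∷ run) wf =
    trans (length-remove (Bullies-∈ (bully-spec (av2-increasing wf) e)))
          (cong suc (Row1Run-length run (Row1Path-wellFormed step wf)))

-- Invariants of the row-1 paths

module _ {B C : List ℕ} where
  open WellFormed

  module _ (P : List ℕ → ℕ → Set)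
           (preserved : ∀ {ℓ b σ σ'} → b ∈ B → Row3Step ℓ b σ σ' → Increasing (av3 σ) →
                        av3 σ ⊆ C → P (av3 σ) (wraps σ) → P (av3 σ') (wraps σ')) where

    Row1Run-preserves₃ : ∀ {as σ σ'} → Row1Run as σ σ' → WellFormed B C σ →
      P (av3 σ) (wraps σ) → P (av3 σ') (wraps σ')
    Row1Run-preserves₃ = Row1Run-preserves (λ τ → P (av3 τ) (wraps τ)) λ where
      (path e step) wf → preserved (av2⊆B wf (Bullies-∈ (bully-spec (av2-increasing wf) e)))
                                   step (av3-increasing wf) (av3⊆C wf)

  -- An entry below all of B can only be bullied by a wrapping.
  taken⇒wrapped : ∀ {c} → (∀ {b} → b ∈ B → c < b) → ∀ {as σ σ'} → Row1Run as σ σ' →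
    WellFormed B C σ → (c ∉ av3 σ → 1 ≤ wraps σ) → c ∉ av3 σ' → 1 ≤ wraps σ'
  taken⇒wrapped {c} B-above = Row1Run-preserves₃ (λ l wr → c ∉ l → 1 ≤ wr) preserved
    where
    preserved : ∀ {ℓ b σ σ'} → b ∈ B → Row3Step ℓ b σ σ' → Increasing (av3 σ) → av3 σ ⊆ C →
      (c ∉ av3 σ → 1 ≤ wraps σ) → c ∉ av3 σ' → 1 ≤ wraps σ'
    preserved b∈B (bullies {a3 = a3} {wr = wr} {y} {w} e) inc _ wrapped c∉ with c ∈? a3
    ... | no c∉a3 = ≤-trans (wrapped c∉a3) (m≤n+m wr (b2n w))
    ... | yes c∈a3 with c ≟ y
    ...   | no c≢y = contradiction (∈-remove⁺ c∈a3 c≢y) c∉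
    ...   | yes refl with bully-spec inc e
    ...     | wrap _ _ _ = s≤s z≤n
    ...     | noWrap _ b<c _ = contradiction (<-trans b<c (B-above b∈B)) (<-irrefl refl)

  -- A wrapping from b happens only once everything available is at most b.
  wrapped⇒taken : ∀ {N} → (∀ {b} → b ∈ B → b < N) → ∀ {as σ σ'} → Row1Run as σ σ' →
    WellFormed B C σ → (1 ≤ wraps σ → N ∉ av3 σ) → 1 ≤ wraps σ' → N ∉ av3 σ'
  wrapped⇒taken {N} B-below = Row1Run-preserves₃ (λ l wr → 1 ≤ wr → N ∉ l) preserved
    where
    preserved : ∀ {ℓ b σ σ'} → b ∈ B → Row3Step ℓ b σ σ' → Increasing (av3 σ) → av3 σ ⊆ C →
      (1 ≤ wraps σ → N ∉ av3 σ) → 1 ≤ wraps σ' → N ∉ av3 σ'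
    preserved b∈B (bullies e) inc _ taken wrapped N∈ with bully-spec inc e
    ... | wrap _ below _ = <⇒≱ (B-below b∈B) (below (∈-remove⁻ N∈))
    ... | noWrap _ _ _ = taken wrapped (∈-remove⁻ N∈)

module TwoSmallest {c₁ c₂ : ℕ} {rest : List ℕ} (C-increasing : Increasing (c₁ ∷ c₂ ∷ rest)) where

  C : List ℕ
  C = c₁ ∷ c₂ ∷ rest

  c₁<c₂ : c₁ < c₂
  c₁<c₂ = All.lookup (AllPairs.head C-increasing) (here refl)

  ≤c₂⇒c₁ : ∀ {y} → y ∈ C → y ≤ c₂ → y ≢ c₂ → y ≡ c₁
  ≤c₂⇒c₁ (here refl) _ _ = refl
  ≤c₂⇒c₁ (there (here refl)) _ y≢c₂ = contradiction refl y≢c₂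
  ≤c₂⇒c₁ (there (there y∈)) y≤c₂ _ =
    contradiction y≤c₂ (<⇒≱ (All.lookup (AllPairs.head (AllPairs.tail C-increasing)) y∈))

  wrap⇒c₁ : ∀ {l b y} → l ⊆ C → c₂ ∈ l → Bullies b l y true → y ≢ c₂ → y ≡ c₁
  wrap⇒c₁ l⊆C c₂∈l (wrap y∈l _ minimum) = ≤c₂⇒c₁ (l⊆C y∈l) (minimum c₂∈l)

  below-c₂⇒c₁ : ∀ {l b y w} → l ⊆ C → c₂ ∈ l → b < c₂ → Bullies b l y w → y ≢ c₂ →
    w ≡ false × y ≡ c₁
  below-c₂⇒c₁ l⊆C c₂∈l b<c₂ (wrap _ below _) _ = contradiction (below c₂∈l) (<⇒≱ b<c₂)
  below-c₂⇒c₁ l⊆C c₂∈l b<c₂ (noWrap y∈l _ least) y≢c₂ =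
    refl , ≤c₂⇒c₁ (l⊆C y∈l) (least c₂∈l b<c₂) y≢c₂

  SingleWrap : List ℕ → ℕ → Set
  SingleWrap l wr = c₂ ∈ l → (c₁ ∈ l → wr ≡ 0) × wr ≤ 1

  Row3Step-singleWrap : ∀ {ℓ b σ σ'} → Row3Step ℓ b σ σ' → Increasing (av3 σ) → av3 σ ⊆ C →
    SingleWrap (av3 σ) (wraps σ) → SingleWrap (av3 σ') (wraps σ')
  Row3Step-singleWrap (bullies {a3 = a3} {y = y} e) inc a3⊆C single c₂∈ with bully-spec inc e
  ... | noWrap _ _ _ = let unwrapped , wr≤1 = single (∈-remove⁻ c₂∈)
                       in unwrapped ∘ ∈-remove⁻ , wr≤1
  ... | spec@(wrap y∈a3 _ _) with refl ← wrap⇒c₁ a3⊆C (∈-remove⁻ c₂∈) spec (∈-remove⇒≢ inc c₂∈ ∘ sym) =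
    (λ c₁∈ → contradiction refl (∈-remove⇒≢ inc c₁∈)) ,
    s≤s (≤-reflexive (proj₁ (single (∈-remove⁻ c₂∈)) y∈a3))

  module _ {B : List ℕ} where
    open WellFormed

    TookC₁Below : ℕ → St → Set
    TookC₁Below b₀ τ = c₂ ∈ av3 τ → b₀ ∉ av2 τ → wraps τ ≡ 0 × c₁ ∉ av3 τ

    -- The path through b₀ < c₂ takes c₁ without wrapping, after which a wrapping would have to
    -- land on the missing c₁.
    low-entry⇒noWrap : ∀ {b₀} → b₀ < c₂ → ∀ {as σ σ'} → Row1Run as σ σ' → WellFormed B C σ →
      SingleWrap (av3 σ) (wraps σ) × TookC₁Below b₀ σ →
      SingleWrap (av3 σ') (wraps σ') × TookC₁Below b₀ σ'
    low-entry⇒noWrap {b₀} b₀<c₂ = Row1Run-preserves _ preserved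
      where
      preserved : ∀ {a σ σ'} → Row1Path a σ σ' → WellFormed B C σ →
        SingleWrap (av3 σ) (wraps σ) × TookC₁Below b₀ σ →
        SingleWrap (av3 σ') (wraps σ') × TookC₁Below b₀ σ'
      preserved (path {a2 = a2} {b = b} _ step@(bullies {a3 = a3} {lb} {wr} {y} {w} e)) wf
                (single , took) =
        Row3Step-singleWrap step inc (av3⊆C wf) single , took′
        where
        inc : Increasing a3
        inc = av3-increasing wf
        took′ : TookC₁Below b₀ (st (remove b a2) (remove y a3) ((y , 1) ∷ lb) (b2n w + wr))
        took′ c₂∈ = took″ (∈-remove⁻ c₂∈) (∈-remove⇒≢ inc c₂∈ ∘ sym)
          where
          took″ : c₂ ∈ a3 → y ≢ c₂ → b₀ ∉ remove b a2 → b2n w + wr ≡ 0 × c₁ ∉ remove y a3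
          took″ c₂∈a3 y≢c₂ b₀∉ with b₀ ∈? a2
          ... | no b₀∉a2 with wr≡0 , c₁∉a3 ← took c₂∈a3 b₀∉a2 | bully-spec inc e
          ...   | noWrap _ _ _ = wr≡0 , c₁∉a3 ∘ ∈-remove⁻
          ...   | spec@(wrap y∈a3 _ _) =
                    contradiction (subst (_∈ a3) (wrap⇒c₁ (av3⊆C wf) c₂∈a3 spec y≢c₂) y∈a3) c₁∉a3
          took″ c₂∈a3 y≢c₂ b₀∉ | yes b₀∈a2 with b₀ ≟ b
          ... | no b₀≢b = contradiction (∈-remove⁺ b₀∈a2 b₀≢b) b₀∉
          ... | yes refl with spec ← bully-spec inc e
                with refl , refl ← below-c₂⇒c₁ (av3⊆C wf) c₂∈a3 b₀<c₂ spec y≢c₂ =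
            proj₁ (single c₂∈a3) (Bullies-∈ spec) , λ c₁∈ → contradiction refl (∈-remove⇒≢ inc c₁∈)

-- A potential counting the wrappings and the disappearance of N

missing : ℕ → List ℕ → ℕ
missing x l = if does (x ∈? l) then 0 else 1

missing-∈ : ∀ {x l} → x ∈ l → missing x l ≡ 0
missing-∈ {x} {l} x∈l rewrite dec-true (x ∈? l) x∈l = refl

missing-∉ : ∀ {x l} → x ∉ l → missing x l ≡ 1
missing-∉ {x} {l} x∉l rewrite dec-false (x ∈? l) x∉l = refl

missing≤1 : ∀ x l → missing x l ≤ 1
missing≤1 x l with does (x ∈? l)
... | true = z≤n
... | false = ≤-refl

missing-remove : ∀ {x y l} → x ≢ y → missing x (remove y l) ≡ missing x l
missing-remove {x} {y} {l} x≢y with x ∈? l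
... | yes x∈l = missing-∈ (∈-remove⁺ x∈l x≢y)
... | no x∉l = missing-∉ (x∉l ∘ ∈-remove⁻)

countAbove : ℕ → List ℕ → ℕ
countAbove c []       = 0
countAbove c (a ∷ as) = b2n (c <ᵇ a) + countAbove c as

module Potential (N : ℕ) where

  potential : St → ℕ
  potential τ = missing N (av3 τ) + wraps τ

  -- A wrapping leaves nothing above b available, and taking N without wrapping leaves
  -- nothing between b and N.
  Row3Step-potential : ∀ {ℓ b σ σ' yS} → Row3Step ℓ b σ σ' → Increasing (av3 σ) →
    (∀ {x} → x ∈ av3 σ → x ≤ N) → yS ∈ av3 σ' →
    potential σ' ≤ potential σ ⊎ (yS ≤ b × potential σ' ≤ suc (potential σ))
  Row3Step-potential (bullies {a3 = a3} {wr = wr} {y} e) inc ≤N yS∈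
    with yS∈a3 ← ∈-remove⁻ {y = y} {l = a3} yS∈ | yS≢y ← ∈-remove⇒≢ {y = y} inc yS∈
       | bully-spec inc e
  ... | wrap _ below minimum = inj₂ (below yS∈a3 , ≤-reflexive (begin
        missing N (remove y a3) + suc wr ≡⟨ cong (_+ suc wr) (missing-remove {l = a3} N≢y) ⟩
        missing N a3 + suc wr           ≡⟨ +-suc (missing N a3) wr ⟩
        suc (missing N a3 + wr)         ∎))
    where
    open ≡-Reasoning
    N≢y : N ≢ y
    N≢y refl = <⇒≱ (≤∧≢⇒< (minimum yS∈a3) (yS≢y ∘ sym)) (≤N yS∈a3)
  ... | spec@(noWrap y∈a3 _ _) with N ≟ y
  ...   | no N≢y = inj₁ (≤-reflexive (cong (_+ wr) (missing-remove {l = a3} N≢y)))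
  ...   | yes refl rewrite missing-∈ y∈a3 =
          inj₂ (Bullies-skipped spec yS∈a3 (≤∧≢⇒< (≤N yS∈a3) yS≢y) ,
                +-monoˡ-≤ wr (missing≤1 N (remove N a3)))

  module _ {B C : List ℕ} {c : ℕ} (B-above : ∀ {b} → b ∈ B → c < b)
           (C≤N : ∀ {x} → x ∈ C → x ≤ N) where
    open WellFormed

    -- A rise forces the bullied b above the surviving bS, so bS was skipped: c < bS ≤ a.
    Row1Path-potential : ∀ {a σ σ' bS yS} → Row1Path a σ σ' → WellFormed B C σ →
      bS ∈ av2 σ' → yS ∈ av3 σ' → bS < yS → potential σ' ≤ potential σ + b2n (c <ᵇ a)
    Row1Path-potential {a} {σ} {bS = bS} (path {a2 = a2} e step@(bullies _)) wf bS∈ yS∈ bS<yS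
      with Row3Step-potential step (av3-increasing wf) (C≤N ∘ av3⊆C wf) yS∈
    ... | inj₁ φ′≤φ = ≤-trans φ′≤φ (m≤m+n (potential σ) _)
    ... | inj₂ (yS≤b , φ′≤1+φ) = ≤-trans φ′≤1+φ (≤-reflexive (begin
          suc (potential σ)              ≡⟨ +-comm 1 (potential σ) ⟩
          potential σ + 1                ≡⟨ cong (λ k → potential σ + b2n k) (<ᵇ-true c<a) ⟨
          potential σ + b2n (c <ᵇ a)     ∎))
      where
      open ≡-Reasoning
      bS∈a2 : bS ∈ a2
      bS∈a2 = ∈-remove⁻ bS∈
      c<a : c < a
      c<a = <-≤-trans (B-above (av2⊆B wf bS∈a2))
              (Bullies-skipped (bully-spec (av2-increasing wf) e) bS∈a2 (<-≤-trans bS<yS yS≤b))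

    Row1Run-potential : ∀ {as σ σ' bS yS} → Row1Run as σ σ' → WellFormed B C σ →
      bS ∈ av2 σ' → yS ∈ av3 σ' → bS < yS → potential σ' ≤ potential σ + countAbove c as
    Row1Run-potential {σ = σ} [] _ _ _ _ = m≤m+n (potential σ) 0
    Row1Run-potential {a ∷ as} {σ} {σ'} (_∷_ {τ = τ} step run) wf bS∈ yS∈ bS<yS
      with ⊆₂ , ⊆₃ ← Row1Run-⊆ run = begin
        potential σ'
          ≤⟨ Row1Run-potential run (Row1Path-wellFormed step wf) bS∈ yS∈ bS<yS ⟩
        potential τ + countAbove c as
          ≤⟨ +-monoˡ-≤ _ (Row1Path-potential step wf (⊆₂ bS∈) (⊆₃ yS∈) bS<yS) ⟩
        potential σ + b2n (c <ᵇ a) + countAbove c as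
          ≡⟨ +-assoc (potential σ) _ _ ⟩
        potential σ + countAbove c (a ∷ as) ∎
      where open ≤-Reasoning

-- Characterising a single wrapping

record Rows (A B C : List ℕ) (N : ℕ) : Set where
  field
    B-increasing : Increasing B
    C-increasing : Increasing C
    B∩C≡∅ : ∀ {x} → x ∈ B → x ∉ C
    N∈C : N ∈ C
    C≤N : ∀ {x} → x ∈ C → x ≤ N
    B≤N : ∀ {x} → x ∈ B → x ≤ N
    |B|≡1+|A| : length B ≡ suc (length A)
    C-positive : ∀ {x} → x ∈ C → 1 ≤ x
    -- Below c₂ there are only c₁ and entries of A, once B lies above c₂.
    second-position : ∀ {c₁ c₂ rest} → C ≡ c₁ ∷ c₂ ∷ rest → (∀ {b} → b ∈ B → c₂ < b) →
      c₂ + countAbove c₂ A ≤ 2 + length A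

module OneWrap {A B : List ℕ} {c₁ c₂ : ℕ} {rest : List ℕ} {N : ℕ}
  (rows : Rows A B (c₁ ∷ c₂ ∷ rest) N)
  {σ₁ : St} (row1 : Row1Run A (st B (c₁ ∷ c₂ ∷ rest) [] 0) σ₁)
  {bS yS : ℕ} {w : Bool} (survivor : av2 σ₁ ≡ bS ∷ []) (last : bully bS (av3 σ₁) ≡ just (yS , w))
  (c₁-label : lookupLabel c₁ ((yS , 2) ∷ lab σ₁) ≡ 1)
  (c₂-label : lookupLabel c₂ ((yS , 2) ∷ lab σ₁) ≡ 3) where

  open Rows rows
  open TwoSmallest C-increasing
  open WellFormed
  open Potential N

  wf₀ : WellFormed B C (st B C [] 0)
  wf₀ = initial-wellFormed B-increasing C-increasing

  wf₁ : WellFormed B C σ₁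
  wf₁ = Row1Run-wellFormed row1 wf₀

  c₁∉σ₁ : c₁ ∉ av3 σ₁
  c₁∉σ₁ c₁∈ = contradiction
    (trans (sym (proj₂ (lookupLabel-∷ {lb = lab σ₁} c₁-label λ ()))) (available⇒unlabelled wf₁ c₁∈))
    λ ()

  c₂∈σ₁ : c₂ ∈ av3 σ₁
  c₂∈σ₁ = unlabelled⇒available wf₁ (there (here refl))
            (proj₂ (lookupLabel-∷ {lb = lab σ₁} c₂-label λ ()))

  c₂≢yS : c₂ ≢ yS
  c₂≢yS = proj₁ (lookupLabel-∷ {lb = lab σ₁} c₂-label λ ())

  spec : Bullies bS (av3 σ₁) yS w
  spec = bully-spec (av3-increasing wf₁) last

  last-noWrap : ∀ {w′} → Bullies bS (av3 σ₁) yS w′ → w′ ≡ false × bS < yS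
  last-noWrap (noWrap _ bS<yS _) = refl , bS<yS
  last-noWrap s@(wrap yS∈ _ _) =
    contradiction (subst (_∈ av3 σ₁) (wrap⇒c₁ (av3⊆C wf₁) c₂∈σ₁ s (c₂≢yS ∘ sym)) yS∈) c₁∉σ₁

  last-unwrapped : w ≡ false
  last-unwrapped = proj₁ (last-noWrap spec)

  bS<yS : bS < yS
  bS<yS = proj₂ (last-noWrap spec)

  wraps≤1 : wraps σ₁ ≤ 1
  wraps≤1 = proj₂ (Row1Run-preserves₃ SingleWrap
    (λ _ step → Row3Step-singleWrap step) row1 wf₀ (λ _ → (λ _ → refl) , z≤n) c₂∈σ₁)

  B-above⇒oneWrap : (∀ {b} → b ∈ B → c₂ < b) → wraps σ₁ ≡ 1
  B-above⇒oneWrap B-above = ≤-antisym wraps≤1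
    (taken⇒wrapped (<-trans c₁<c₂ ∘ B-above) row1 wf₀ (λ c₁∉C → contradiction (here refl) c₁∉C) c₁∉σ₁)

  oneWrap⇒B-above : wraps σ₁ ≡ 1 → ∀ {b} → b ∈ B → c₂ < b
  oneWrap⇒B-above oneWrap {b₀} b₀∈B =
    ≰⇒> λ b₀≤c₂ → low-entry b₀∈B (≤∧≢⇒< b₀≤c₂ λ { refl → B∩C≡∅ b₀∈B (there (here refl)) })
    where
    low-entry : ∀ {b₀} → b₀ ∈ B → b₀ < c₂ → ⊥
    low-entry {b₀} b₀∈B b₀<c₂ with b₀ ≟ bS
    ... | yes refl = c₁∉σ₁ (subst (_∈ av3 σ₁)
          (proj₂ (below-c₂⇒c₁ (av3⊆C wf₁) c₂∈σ₁ b₀<c₂ spec (c₂≢yS ∘ sym))) (Bullies-∈ spec))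
    ... | no b₀≢bS = contradiction (trans (sym oneWrap) noWraps) λ ()
      where
      b₀∉σ₁ : b₀ ∉ av2 σ₁
      b₀∉σ₁ b₀∈ with here b₀≡bS ← subst (b₀ ∈_) survivor b₀∈ = b₀≢bS b₀≡bS
      noWraps : wraps σ₁ ≡ 0
      noWraps = proj₁ (proj₂ (low-entry⇒noWrap {B = B} b₀<c₂ row1 wf₀
        ((λ _ → (λ _ → refl) , z≤n) , λ _ b₀∉B → contradiction b₀∈B b₀∉B)) c₂∈σ₁ b₀∉σ₁)

  -- Both the wrapping and the disappearance of N raise the potential, and only paths from
  -- row-1 entries above c₂ can do so.
  oneWrap⇒twoAbove : wraps σ₁ ≡ 1 → 2 ≤ countAbove c₂ A
  oneWrap⇒twoAbove oneWrap = begin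
    2
      ≡⟨ cong₂ _+_ (missing-∉ N∉σ₁) oneWrap ⟨
    potential σ₁
      ≤⟨ Row1Run-potential (oneWrap⇒B-above oneWrap) C≤N row1 wf₀
           (subst (bS ∈_) (sym survivor) (here refl)) (Bullies-∈ spec) bS<yS ⟩
    potential (st B C [] 0) + countAbove c₂ A
      ≡⟨ cong (λ k → k + 0 + countAbove c₂ A) (missing-∈ N∈C) ⟩
    countAbove c₂ A ∎
    where
    open ≤-Reasoning
    N∉σ₁ : N ∉ av3 σ₁
    N∉σ₁ = wrapped⇒taken (λ b∈B → ≤∧≢⇒< (B≤N b∈B) λ { refl → B∩C≡∅ b∈B N∈C }) row1 wf₀
             (λ ()) (≤-reflexive (sym oneWrap))

Row1Run-survivor : ∀ {A B C N σ₁} → Rows A B C N → Row1Run A (st B C [] 0) σ₁ →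
  ∃ λ bS → av2 σ₁ ≡ bS ∷ []
Row1Run-survivor {A} {B} {C} {σ₁ = σ₁} rows row1
  with av2 σ₁ | +-cancelˡ-≡ (length A) _ 1
                  (trans (sym (Row1Run-length row1 wf₀)) (trans |B|≡1+|A| (+-comm 1 (length A))))
  where
  open Rows rows
  wf₀ : WellFormed B C (st B C [] 0)
  wf₀ = initial-wellFormed B-increasing C-increasing
... | bS ∷ [] | _ = bS , refl

bullyRun-final : ∀ {A B C N σf} → Rows A B C N → bullyRun (mlq A B C) ≡ just σf →
  ∃₂ λ σ₁ bS → Row1Run A (st B C [] 0) σ₁ × av2 σ₁ ≡ bS ∷ [] × Row3Step 2 bS σ₁ σf
bullyRun-final rows run with σ₁ , row1 , final ← bullyRun-view run
  with bS , survivor ← Row1Run-survivor rows row1 =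
  σ₁ , bS , row1 , survivor , step23-view (subst (λ l → runRow2 l (just σ₁) ≡ just _) survivor final)

oneWrap-criterion : ∀ {A b₁ B′ c₁ c₂ rest N σf} → Rows A (b₁ ∷ B′) (c₁ ∷ c₂ ∷ rest) N →
  bullyRun (mlq A (b₁ ∷ B′) (c₁ ∷ c₂ ∷ rest)) ≡ just σf →
  lookupLabel c₁ (lab σf) ≡ 1 → lookupLabel c₂ (lab σf) ≡ 3 →
  (wraps σf ≡ 1 → c₂ ≤ length A × c₂ < b₁) × (c₂ < b₁ → wraps σf ≡ 1)
oneWrap-criterion {A} {b₁} {c₂ = c₂} {σf = σf} rows run c₁-label c₂-label
  with σ₁ , bS , row1 , survivor , bullies last ← bullyRun-final rows run
  with refl ← OneWrap.last-unwrapped rows row1 survivor last c₁-label c₂-label = to , from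
  where
  open Rows rows
  open OneWrap rows row1 survivor last c₁-label c₂-label
  to : wraps σf ≡ 1 → c₂ ≤ length A × c₂ < b₁
  to oneWrap = +-cancelʳ-≤ 2 c₂ (length A) (begin
    c₂ + 2                ≤⟨ +-monoʳ-≤ c₂ (oneWrap⇒twoAbove oneWrap) ⟩
    c₂ + countAbove c₂ A  ≤⟨ second-position refl (oneWrap⇒B-above oneWrap) ⟩
    2 + length A          ≡⟨ +-comm 2 (length A) ⟩
    length A + 2          ∎) , oneWrap⇒B-above oneWrap (here refl)
    where open ≤-Reasoning
  from : c₂ < b₁ → wraps σf ≡ 1
  from c₂<b₁ = B-above⇒oneWrap λ
    { (here refl) → c₂<b₁
    ; (there b∈) → <-trans c₂<b₁ (All.lookup (AllPairs.head B-increasing) b∈) }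

inRange : ℕ → ℕ → ℕ → Bool
inRange a m c = (a ≤ᵇ c) ∧ (c <ᵇ a + m)

inRange-reflects : ∀ a m c → Reflects (a ≤ c × c < a + m) (inRange a m c)
inRange-reflects a m c = ≤ᵇ-reflects-≤ a c ×-reflects <ᵇ-reflects-< c (a + m)

secondInRange : ℕ → ℕ → List ℕ → Bool
secondInRange a m (_ ∷ c ∷ _) = inRange a m c
secondInRange a m _           = false

wraps23-just : ∀ {q σf} → bullyRun q ≡ just σf → wraps23 q ≡ just (wraps σf)
wraps23-just {q} run with bullyRun q
wraps23-just refl | just _ = refl

starts13-labels : ∀ {A B c₁ c₂ rest} → T (starts13 (projWord (mlq A B (c₁ ∷ c₂ ∷ rest)))) →
  ∃ λ σf → bullyRun (mlq A B (c₁ ∷ c₂ ∷ rest)) ≡ just σf ×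
           lookupLabel c₁ (lab σf) ≡ 1 × lookupLabel c₂ (lab σf) ≡ 3
starts13-labels {A} {B} {c₁} {c₂} {rest} starts with bullyRun (mlq A B (c₁ ∷ c₂ ∷ rest))
... | just σf with label₁ , label₃ ← Equivalence.to T-∧ starts =
  σf , refl , ≡ᵇ⇒≡ _ 1 label₁ , ≡ᵇ⇒≡ _ 3 label₃

oneWrap-characterisation : ∀ {s A B C N} → Rows A B C N → length A ≡ s →
  T (starts13 (projWord (mlq A B C))) →
  oneWrap (wraps23 (mlq A B C)) ≡ secondInRange 2 (s ∸ 1) C ∧ b1AboveC2 (mlq A B C)
oneWrap-characterisation {B = []} rows _ _ with () ← Rows.|B|≡1+|A| rows
oneWrap-characterisation {A = A} {b₁ ∷ B′} {[]} _ _ starts with bullyRun (mlq A (b₁ ∷ B′) [])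
... | just _ = ⊥-elim starts
... | nothing = ⊥-elim starts
oneWrap-characterisation {A = A} {b₁ ∷ B′} {c ∷ []} _ _ starts with bullyRun (mlq A (b₁ ∷ B′) (c ∷ []))
... | just _ = ⊥-elim starts
... | nothing = ⊥-elim starts
oneWrap-characterisation {s} {A} {b₁ ∷ B′} {c₁ ∷ c₂ ∷ rest} rows refl starts
  with σf , run , c₁-label , c₂-label ← starts13-labels {A} {b₁ ∷ B′} {c₁} {c₂} {rest} starts =
  trans (cong oneWrap (wraps23-just {mlq A (b₁ ∷ B′) (c₁ ∷ c₂ ∷ rest)} run)) (reflects-≡
    (≡ᵇ-reflects-≡ (wraps σf) 1)
    (inRange-reflects 2 (length A ∸ 1) c₂ ×-reflects <ᵇ-reflects-< c₂ b₁)
    (λ oneWrap → let c₂≤|A| , c₂<b₁ = to oneWrap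
                 in (2≤c₂ , s≤s (≤-trans c₂≤|A| (m≤n+m∸n (length A) 1))) , c₂<b₁)
    (from ∘ proj₂))
  where
  open Rows rows
  to : wraps σf ≡ 1 → c₂ ≤ length A × c₂ < b₁
  to = proj₁ (oneWrap-criterion rows run c₁-label c₂-label)
  from : c₂ < b₁ → wraps σf ≡ 1
  from = proj₂ (oneWrap-criterion rows run c₁-label c₂-label)
  2≤c₂ : 2 ≤ c₂
  2≤c₂ = ≤-trans (s≤s (C-positive (here refl))) (TwoSmallest.c₁<c₂ C-increasing)

entries-bounds-suc : ∀ {k n x} → suc k ≤ x × x < suc k + n → k ≤ x × x < k + suc n
entries-bounds-suc {k} {n} (k<x , x<) = <⇒≤ k<x , ≤-trans x< (≤-reflexive (sym (+-suc k n)))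

entries-bounds : ∀ p k w {x} → x ∈ entries p k w → k ≤ x × x < k + length w
entries-bounds p k (r ∷ w) x∈ with p r | x∈
... | true  | here refl = ≤-refl , m<m+n k z<s
... | true  | there x∈′ = entries-bounds-suc (entries-bounds p (suc k) w x∈′)
... | false | x∈′       = entries-bounds-suc (entries-bounds p (suc k) w x∈′)

∈-entries-suc⇒> : ∀ p k w {x} → x ∈ entries p (suc k) w → k < x
∈-entries-suc⇒> p k w = proj₁ ∘ entries-bounds p (suc k) w

entries-increasing : ∀ p k w → Increasing (entries p k w)
entries-increasing p k [] = []
entries-increasing p k (r ∷ w) with p r
... | true  = All.tabulate (∈-entries-suc⇒> p k w) ∷ entries-increasing p (suc k) w
... | false = entries-increasing p (suc k) w

length-entries : ∀ p k w → length (entries p k w) ≡ count p w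
length-entries p k [] = refl
length-entries p k (r ∷ w) with p r
... | true  = cong suc (length-entries p (suc k) w)
... | false = length-entries p (suc k) w

entries₂∩entries₃≡∅ : ∀ k w {x} → x ∈ entries isR2 k w → x ∉ entries isR3 k w
entries₂∩entries₃≡∅ k (r1 ∷ w) x∈₂ x∈₃ = entries₂∩entries₃≡∅ (suc k) w x∈₂ x∈₃
entries₂∩entries₃≡∅ k (r2 ∷ w) (here refl) x∈₃ = <-irrefl refl (∈-entries-suc⇒> isR3 k w x∈₃)
entries₂∩entries₃≡∅ k (r2 ∷ w) (there x∈₂) x∈₃ = entries₂∩entries₃≡∅ (suc k) w x∈₂ x∈₃
entries₂∩entries₃≡∅ k (r3 ∷ w) x∈₂ (here refl) = <-irrefl refl (∈-entries-suc⇒> isR2 k w x∈₂)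
entries₂∩entries₃≡∅ k (r3 ∷ w) x∈₂ (there x∈₃) = entries₂∩entries₃≡∅ (suc k) w x∈₂ x∈₃

countAbove≤length : ∀ c as → countAbove c as ≤ length as
countAbove≤length c [] = z≤n
countAbove≤length c (a ∷ as) with c <ᵇ a
... | true  = s≤s (countAbove≤length c as)
... | false = m≤n⇒m≤1+n (countAbove≤length c as)

-- The entries k, …, c - 1 preceding the first row-3 entry c lie in row 1 and are below c.
entries-first-position : ∀ k w {c rest} → entries isR3 k w ≡ c ∷ rest →
  (∀ {b} → b ∈ entries isR2 k w → c < b) →
  c + countAbove c (entries isR1 k w) ≤ k + length (entries isR1 k w)
entries-first-position k (r1 ∷ w) {c} e B-above
  rewrite <ᵇ-false (<⇒≯ (∈-entries-suc⇒> isR3 k w (subst (c ∈_) (sym e) (here refl)))) =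
  ≤-trans (entries-first-position (suc k) w e B-above) (≤-reflexive (sym (+-suc k _)))
entries-first-position k (r2 ∷ w) {c} e B-above = contradiction (B-above (here refl))
  (<⇒≯ (∈-entries-suc⇒> isR3 k w (subst (c ∈_) (sym e) (here refl))))
entries-first-position k (r3 ∷ w) refl _ = +-monoʳ-≤ k (countAbove≤length k (entries isR1 (suc k) w))

entries-second-position : ∀ k w {c₁ c₂ rest} → entries isR3 k w ≡ c₁ ∷ c₂ ∷ rest →
  (∀ {b} → b ∈ entries isR2 k w → c₂ < b) →
  c₂ + countAbove c₂ (entries isR1 k w) ≤ suc k + length (entries isR1 k w)
entries-second-position k (r1 ∷ w) {c₂ = c₂} e B-above
  rewrite <ᵇ-false (<⇒≯ (∈-entries-suc⇒> isR3 k w (subst (c₂ ∈_) (sym e) (there (here refl))))) =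
  ≤-trans (entries-second-position (suc k) w e B-above) (≤-reflexive (cong suc (sym (+-suc k _))))
entries-second-position k (r2 ∷ w) {c₂ = c₂} e B-above = contradiction (B-above (here refl))
  (<⇒≯ (∈-entries-suc⇒> isR3 k w (subst (c₂ ∈_) (sym e) (there (here refl)))))
entries-second-position k (r3 ∷ w) e B-above =
  entries-first-position (suc k) w (proj₂ (∷-injective e)) B-above

lastIs⇒∈ : ∀ {N} l → T (lastIs N l) → N ∈ l
lastIs⇒∈ (x ∷ [])    last = here (sym (≡ᵇ⇒≡ x _ last))
lastIs⇒∈ (x ∷ y ∷ l) last = there (lastIs⇒∈ (y ∷ l) last)

hasType⇒lengths : ∀ {s t n} w → T (hasType s t n w) →
  length (entries isR1 1 w) ≡ s × length (entries isR2 1 w) ≡ s + t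
hasType⇒lengths w type with count₁ , counts₂₃ ← Equivalence.to T-∧ type
                        with count₂ , _ ← Equivalence.to T-∧ counts₂₃ =
  trans (length-entries isR1 1 w) (≡ᵇ⇒≡ _ _ count₁) , trans (length-entries isR2 1 w) (≡ᵇ⇒≡ _ _ count₂)

word-rows : ∀ {s n} w → T (hasType s 1 n w) → T (lastIs (length w) (entries isR3 1 w)) →
  Rows (entries isR1 1 w) (entries isR2 1 w) (entries isR3 1 w) (length w)
word-rows {s} w type last with |A|≡s , |B|≡s+1 ← hasType⇒lengths w type = record
  { B-increasing = entries-increasing isR2 1 w
  ; C-increasing = entries-increasing isR3 1 w
  ; B∩C≡∅ = entries₂∩entries₃≡∅ 1 w
  ; N∈C = lastIs⇒∈ _ last
  ; C≤N = ≤-pred ∘ proj₂ ∘ entries-bounds isR3 1 w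
  ; B≤N = ≤-pred ∘ proj₂ ∘ entries-bounds isR2 1 w
  ; |B|≡1+|A| = trans |B|≡s+1 (trans (+-comm s 1) (cong suc (sym |A|≡s)))
  ; C-positive = proj₁ ∘ entries-bounds isR3 1 w
  ; second-position = entries-second-position 1 w
  }

words-length : ∀ m {w} → w ∈ words m → length w ≡ m
words-length zero (here refl) = refl
words-length (suc m) w∈
  with find (∈-concatMap⁻ (λ v → (r1 ∷ v) ∷ (r2 ∷ v) ∷ (r3 ∷ v) ∷ []) {xs = words m} w∈)
... | _ , v∈ , here refl                 = cong suc (words-length m v∈)
... | _ , v∈ , there (here refl)         = cong suc (words-length m v∈)
... | _ , v∈ , there (there (here refl)) = cong suc (words-length m v∈)

∈-cMLQs : ∀ {s t n q} → q ∈ cMLQs s t n →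
  ∃ λ w → length w ≡ n + 2 * s + t × T (hasType s t n w) × q ≡ toMLQ w
∈-cMLQs q∈ with w , w∈ , refl ← ∈-map⁻ toMLQ q∈ with w∈words , type ← ∈-filter⁻ (λ w → T? _) w∈ =
  w , words-length _ w∈words , type , refl

countWhere-∷ : ∀ p q L → countWhere p (q ∷ L) ≡ b2n (p q) + countWhere p L
countWhere-∷ p q L with p q
... | true  = refl
... | false = refl

countWhere-cong : ∀ {p p′ L} → (∀ {q} → q ∈ L → p q ≡ p′ q) → countWhere p L ≡ countWhere p′ L
countWhere-cong {L = []} _ = refl
countWhere-cong {p} {p′} {q ∷ L} p≗p′ = begin
  countWhere p (q ∷ L)
    ≡⟨ countWhere-∷ p q L ⟩
  b2n (p q) + countWhere p L
    ≡⟨ cong₂ _+_ (cong b2n (p≗p′ (here refl))) (countWhere-cong (p≗p′ ∘ there)) ⟩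
  b2n (p′ q) + countWhere p′ L
    ≡⟨ countWhere-∷ p′ q L ⟨
  countWhere p′ (q ∷ L) ∎
  where open ≡-Reasoning

sum-map-zero : ∀ {X : Set} (xs : List X) → sum (map (λ _ → 0) xs) ≡ 0
sum-map-zero []       = refl
sum-map-zero (_ ∷ xs) = sum-map-zero xs

sum-map-+ : ∀ {X : Set} (f g : X → ℕ) xs →
  sum (map (λ x → f x + g x) xs) ≡ sum (map f xs) + sum (map g xs)
sum-map-+ f g []       = refl
sum-map-+ f g (x ∷ xs) = trans (cong (f x + g x +_) (sum-map-+ f g xs)) (interchange (f x) (g x) _ _)

sum-countWhere : ∀ (p : ℕ → MLQ → Bool) (r : MLQ → Bool) is L →
  (∀ q → sum (map (λ i → b2n (p i q)) is) ≡ b2n (r q)) →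
  sum (map (λ i → countWhere (p i) L) is) ≡ countWhere r L
sum-countWhere p r is []      _ = sum-map-zero is
sum-countWhere p r is (q ∷ L) pointwise = begin
  sum (map (λ i → countWhere (p i) (q ∷ L)) is)
    ≡⟨ cong sum (map-cong (λ i → countWhere-∷ (p i) q L) is) ⟩
  sum (map (λ i → b2n (p i q) + countWhere (p i) L) is)
    ≡⟨ sum-map-+ (λ i → b2n (p i q)) (λ i → countWhere (p i) L) is ⟩
  sum (map (λ i → b2n (p i q)) is) + sum (map (λ i → countWhere (p i) L) is)
    ≡⟨ cong₂ _+_ (pointwise q) (sum-countWhere p r is L pointwise) ⟩
  b2n (r q) + countWhere r L
    ≡⟨ countWhere-∷ r q L ⟨
  countWhere r (q ∷ L) ∎
  where open ≡-Reasoning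

b2n-+ : ∀ {P Q R : Set} {p q r} → Reflects P p → Reflects Q q → Reflects R r →
  ¬ (P × Q) → (P ⊎ Q → R) → (R → P ⊎ Q) → b2n p + b2n q ≡ b2n r
b2n-+ (ofʸ p) (ofʸ q) _        disjoint _  _    = contradiction (p , q) disjoint
b2n-+ (ofʸ _) (ofⁿ _) (ofʸ _)  _        _  _    = refl
b2n-+ (ofʸ p) (ofⁿ _) (ofⁿ ¬r) _        to _    = contradiction (to (inj₁ p)) ¬r
b2n-+ (ofⁿ _) (ofʸ _) (ofʸ _)  _        _  _    = refl
b2n-+ (ofⁿ _) (ofʸ q) (ofⁿ ¬r) _        to _    = contradiction (to (inj₂ q)) ¬r
b2n-+ (ofⁿ ¬p) (ofⁿ ¬q) (ofʸ r) _       _  from = ⊥-elim ([ ¬p , ¬q ] (from r))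
b2n-+ (ofⁿ _) (ofⁿ _) (ofⁿ _)  _        _  _    = refl

sum-indicator : ∀ a m c → sum (map (λ i → b2n (c ≡ᵇ a + i)) (upTo m)) ≡ b2n (inRange a m c)
sum-indicator a zero c = cong b2n (det (ofⁿ empty) (inRange-reflects a 0 c))
  where
  empty : ¬ (a ≤ c × c < a + 0)
  empty (a≤c , c<a) = <⇒≱ (subst (c <_) (+-identityʳ a) c<a) a≤c
sum-indicator a (suc m) c = begin
  sum (map h (upTo (suc m)))                ≡⟨ cong (sum ∘ map h) (upTo-∷ʳ m) ⟨
  sum (map h (upTo m ∷ʳ m))                 ≡⟨ cong sum (map-++ h (upTo m) (m ∷ [])) ⟩
  sum (map h (upTo m) ++ h m ∷ [])          ≡⟨ sum-++ (map h (upTo m)) (h m ∷ []) ⟩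
  sum (map h (upTo m)) + (h m + 0)          ≡⟨ cong₂ _+_ (sum-indicator a m c) (+-identityʳ (h m)) ⟩
  b2n (inRange a m c) + b2n (c ≡ᵇ a + m)    ≡⟨ b2n-+ (inRange-reflects a m c) (≡ᵇ-reflects-≡ c (a + m))
                                                      (inRange-reflects a (suc m) c) disjoint to from ⟩
  b2n (inRange a (suc m) c)                 ∎
  where
  open ≡-Reasoning
  h : ℕ → ℕ
  h i = b2n (c ≡ᵇ a + i)
  disjoint : ¬ ((a ≤ c × c < a + m) × c ≡ a + m)
  disjoint ((_ , c<a+m) , refl) = <-irrefl refl c<a+m
  to : (a ≤ c × c < a + m) ⊎ c ≡ a + m → a ≤ c × c < a + suc m
  to (inj₁ (a≤c , c<a+m)) = a≤c , <-≤-trans c<a+m (+-monoʳ-≤ a (n≤1+n m))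
  to (inj₂ refl) = m≤m+n a m , +-monoʳ-< a (n<1+n m)
  from : a ≤ c × c < a + suc m → (a ≤ c × c < a + m) ⊎ c ≡ a + m
  from (a≤c , c<) with m≤n⇒m<n∨m≡n (≤-pred (subst (c <_) (+-suc a m) c<))
  ... | inj₁ c<a+m = inj₁ (a≤c , c<a+m)
  ... | inj₂ c≡a+m = inj₂ c≡a+m

sum-secondIs : ∀ a m C → sum (map (λ i → b2n (secondIs (a + i) C)) (upTo m)) ≡ b2n (secondInRange a m C)
sum-secondIs a m []              = sum-map-zero (upTo m)
sum-secondIs a m (_ ∷ [])        = sum-map-zero (upTo m)
sum-secondIs a m (_ ∷ c ∷ _)     = sum-indicator a m c

sum-b2n-∧ : ∀ (f : ℕ → Bool) g x is → sum (map (λ i → b2n (f i)) is) ≡ b2n g →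
  sum (map (λ i → b2n (f i ∧ x)) is) ≡ b2n (g ∧ x)
sum-b2n-∧ f g true is sum≡ =
  trans (cong sum (map-cong (λ i → cong b2n (∧-identityʳ (f i))) is))
        (trans sum≡ (cong b2n (sym (∧-identityʳ g))))
sum-b2n-∧ f g false is _ =
  trans (cong sum (map-cong (λ i → cong b2n (∧-zeroʳ (f i))) is))
        (trans (sum-map-zero is) (cong b2n (sym (∧-zeroʳ g))))

∧-rearrange : ∀ ℓ o s r b → (T ℓ → T s → o ≡ r ∧ b) → ℓ ∧ (o ∧ s) ≡ r ∧ (ℓ ∧ (b ∧ s))
∧-rearrange false _ _     r _ _ = sym (∧-zeroʳ r)
∧-rearrange true  o false r b _ = trans (∧-zeroʳ o) (sym (trans (cong (r ∧_) (∧-zeroʳ b)) (∧-zeroʳ r)))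
∧-rearrange true  o true  r b o≡r∧b
  rewrite o≡r∧b _ _ | ∧-identityʳ (r ∧ b) | ∧-identityʳ b = refl

lemma5p8 : (s n : ℕ) → 1 ≤ s → s + 1 < n →
    β13 s 1 n ≡ sumFromTo 2 s (λ ℓ → γ ℓ s n)
lemma5p8 s n _ _ = begin
  β13 s 1 n
    ≡⟨ countWhere-cong rearranged ⟩
  countWhere (λ q → secondInRange 2 (s ∸ 1) (row3 q) ∧ γ-condition q) (cMLQs s 1 n)
    ≡⟨ sum-countWhere _ _ (upTo (s ∸ 1)) (cMLQs s 1 n)
         (λ q → sum-b2n-∧ _ _ (γ-condition q) (upTo (s ∸ 1)) (sum-secondIs 2 (s ∸ 1) (row3 q))) ⟨
  sumFromTo 2 s (λ ℓ → γ ℓ s n) ∎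
  where
  open ≡-Reasoning
  N : ℕ
  N = n + 2 * s + 1
  γ-condition : MLQ → Bool
  γ-condition q = lastIs N (row3 q) ∧ (b1AboveC2 q ∧ starts13 (projWord q))
  rearranged : ∀ {q} → q ∈ cMLQs s 1 n →
    lastIs N (row3 q) ∧ (oneWrap (wraps23 q) ∧ starts13 (projWord q)) ≡
    secondInRange 2 (s ∸ 1) (row3 q) ∧ γ-condition q
  rearranged q∈ with w , |w|≡N , type , refl ← ∈-cMLQs {s} {1} {n} q∈ =
    ∧-rearrange (lastIs N C) (oneWrap (wraps23 q)) (starts13 (projWord q))
                (secondInRange 2 (s ∸ 1) C) (b1AboveC2 q)
      λ last → oneWrap-characterisation
                 (word-rows w type (subst (λ N → T (lastIs N C)) (sym |w|≡N) last))
                 (proj₁ (hasType⇒lengths {s} {1} {n} w type))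
    where
    q : MLQ
    q = toMLQ w
    C : List ℕ
    C = entries isR3 1 w
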